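{- Let $A$ be a Boolean algebra and $X\subseteq A$. If $A$ is $\omega$-free over $X$, then $X^+=X\smallsetminus\{0\}$ is $\omega$-independent.
   Context: For Boolean algebras $A,B$ (nontrivial) and $U\subseteq A$, a function $f:U\to B$ is $\omega$-preserving if for every finite $H\subseteq U$, $\prod H=0$ implies $\prod f[H]=0$. $A$ is $\omega$-free over $X\subseteq A$ if every $\omega$-preserving function from $X$ into an arbitrary nontrivial Boolean algebra $B$ extends to a unique homomorphism $A\to B$. A subset $X\subseteq A$ is $\omega$-independent if $0\notin X$ and for all nonempty finite $F,G\subseteq X$: $(\perp1)$ $\sum F\neq 1$; $(\perp3)$ if $0\neq\prod F\le\sum G$ then $F\cap G\neq\emptyset$. -}

module Defs where

open import Level using (Level; _⊔_; suc; Setω)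
open import Data.List using (List; []; _∷_; map; foldr)
open import Data.List.Membership.Propositional using (_∈_)
open import Data.Product using (Σ; Σ-syntax; _×_; _,_; proj₁; ∃-syntax)
open import Relation.Nullary using (¬_)
open import Relation.Binary.PropositionalEquality using (_≡_)
open import Algebra.Lattice.Bundles using (BooleanAlgebra)

module _ {a ℓa : Level} (A : BooleanAlgebra a ℓa) where
  open BooleanAlgebra A hiding (¬_)

  ∏ : List Carrier → Carrier
  ∏ = foldr _∧_ ⊤

  ∑ : List Carrier → Carrier
  ∑ = foldr _∨_ ⊥

  _≤_ : Carrier → Carrier → Set ℓa
  x ≤ y = x ∧ y ≈ x

  Nontrivial : Set ℓa
  Nontrivial = ¬ (⊤ ≈ ⊥)

Subset : ∀ {a ℓa} (A : BooleanAlgebra a ℓa) (p : Level) → Set (a ⊔ suc p)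
Subset A p = BooleanAlgebra.Carrier A → Set p

El : ∀ {a ℓa p} (A : BooleanAlgebra a ℓa) → Subset A p → Set (a ⊔ p)
El A U = Σ (BooleanAlgebra.Carrier A) U

Plus : ∀ {a ℓa p} (A : BooleanAlgebra a ℓa) → Subset A p → Subset A (p ⊔ ℓa)
Plus A X x = X x × ¬ (x ≈ ⊥)
  where open BooleanAlgebra A hiding (¬_)

record IsBAHom {a ℓa b ℓb} (A : BooleanAlgebra a ℓa) (B : BooleanAlgebra b ℓb)
       (h : BooleanAlgebra.Carrier A → BooleanAlgebra.Carrier B) : Set (a ⊔ ℓa ⊔ ℓb) where
  private
    module A = BooleanAlgebra A
    module B = BooleanAlgebra B
  field
    cong  : ∀ {x y} → x A.≈ y → h x B.≈ h y
    ∨-hom : ∀ x y → h (x A.∨ y) B.≈ (h x B.∨ h y)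
    ∧-hom : ∀ x y → h (x A.∧ y) B.≈ (h x B.∧ h y)
    ¬-hom : ∀ x → h (A.¬ x) B.≈ B.¬ (h x)
    ⊤-hom : h A.⊤ B.≈ B.⊤
    ⊥-hom : h A.⊥ B.≈ B.⊥

module _ {a ℓa b ℓb p} (A : BooleanAlgebra a ℓa) (B : BooleanAlgebra b ℓb) (U : Subset A p) where
  private
    module A = BooleanAlgebra A
    module B = BooleanAlgebra B

  record SubFun : Set (a ⊔ ℓa ⊔ b ⊔ ℓb ⊔ p) where
    field
      fun  : (x : A.Carrier) → U x → B.Carrier
      resp : ∀ {x y} (px : U x) (py : U y) → x A.≈ y → fun x px B.≈ fun y py

  apply : SubFun → El A U → B.Carrier
  apply f (x , px) = SubFun.fun f x px

  OmegaPreserving : SubFun → Set (a ⊔ ℓa ⊔ ℓb ⊔ p)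
  OmegaPreserving f = (H : List (El A U)) →
    ∏ A (map proj₁ H) A.≈ A.⊥ → ∏ B (map (apply f) H) B.≈ B.⊥

  Extends : SubFun → (A.Carrier → B.Carrier) → Set (a ⊔ ℓb ⊔ p)
  Extends f h = ∀ x (px : U x) → h x B.≈ SubFun.fun f x px

OmegaFree : ∀ {a ℓa p} (A : BooleanAlgebra a ℓa) → Subset A p → Setω
OmegaFree {a} {ℓa} {p} A X =
  ∀ {b ℓb} (B : BooleanAlgebra b ℓb) → Nontrivial B →
  (f : SubFun A B X) → OmegaPreserving A B X f →
    (Σ[ h ∈ (BooleanAlgebra.Carrier A → BooleanAlgebra.Carrier B) ]
       (IsBAHom A B h × Extends A B X f h))
    × (∀ h₁ h₂ → IsBAHom A B h₁ → Extends A B X f h₁ →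
                  IsBAHom A B h₂ → Extends A B X f h₂ →
                  ∀ x → BooleanAlgebra._≈_ B (h₁ x) (h₂ x))

module _ {a ℓa p} (A : BooleanAlgebra a ℓa) (X : Subset A p) where
  private module A = BooleanAlgebra A

  NonEmpty : ∀ {t} {T : Set t} → List T → Set t
  NonEmpty L = ¬ (L ≡ [])

  record OmegaIndependent : Set (a ⊔ ℓa ⊔ p) where
    field
      zero∉ : ∀ x → X x → ¬ (x A.≈ A.⊥)
      ⊥1    : (F : List (El A X)) → NonEmpty F →
              ¬ (∑ A (map proj₁ F) A.≈ A.⊤)
      ⊥3    : (F G : List (El A X)) → NonEmpty F → NonEmpty G →
              ¬ (∏ A (map proj₁ F) A.≈ A.⊥) →
              _≤_ A (∏ A (map proj₁ F)) (∑ A (map proj₁ G)) →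
              ∃[ x ] (x ∈ F × ∃[ y ] (y ∈ G × proj₁ x A.≈ proj₁ y))

module Submission where

-- Classically one tests (⊥1) and (⊥3) against ω-preserving maps into the
-- two-element algebra 2.  For (⊥1), the constant map X → {0} is ω-preserving
-- (A is nontrivial, so every finite H with ∏H = 0 is nonempty); its homomorphic
-- extension h would send ∑F = 1 to 0.  For (⊥3), the map "x ↦ [x ∈ F]" is
-- ω-preserving because ∏F ≠ 0, and its extension turns ∏F ≤ ∑G into: some
-- member of G lies in F.  Constructively "x ∈ F" (up to ≈) is not decidable,
-- so we replace 2 by the algebra Props R of all propositions, identified when
-- their R-negations agree (R := the conclusion of (⊥3)); this is a Boolean
-- algebra with bottom R, in which ∏F ≤ ∑G with ∏F inhabited yields R.  Since
-- Props R is trivial when R holds, we use Props R × Bool, nontrivial via Bool.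

open import Level using (_⊔_; lift) renaming (suc to lsuc)
open import Data.Bool using (true; false)
open import Data.Bool.Properties using (∨-∧-booleanAlgebra)
open import Data.Empty using (⊥-elim) renaming (⊥ to Empty)
open import Data.List using (List; []; _∷_; map)
open import Data.List.Membership.Propositional using (_∈_)
open import Data.List.Relation.Unary.Any using (here; there)
open import Data.Product using (_×_; _,_; proj₁; proj₂; ∃-syntax; swap)
open import Data.Product.Algebra using (×-comm; ×-assoc)
open import Data.Product.Relation.Binary.Pointwise.NonDependent using (Pointwise; ×-isEquivalence)
open import Data.Sum using (_⊎_; inj₁; inj₂; [_,_])
open import Data.Sum.Algebra using (⊎-comm; ⊎-assoc)
open import Data.Unit using (tt)
open import Function using (id; _∘_; _↔_; Inverse)
open import Relation.Binary.PropositionalEquality as ≡ using (_≡_)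
open import Relation.Nullary using (¬_)
open import Algebra.Lattice.Bundles using (BooleanAlgebra)
open import Algebra.Lattice.Structures using (IsLattice)
open import Algebra.Lattice.Structures.Biased using (isDistributiveLatticeʳʲᵐ; isBooleanAlgebraʳ)
import Algebra.Lattice.Properties.BooleanAlgebra as BooleanAlgebraProperties
import Relation.Binary.Reasoning.Setoid as SetoidReasoning
open import Defs

-- Meet is ×, join is ⊎, bottom is R itself.
-- This is the algebra of the R-double-negation (Friedman) translation.
module PropositionAlgebra {ℓ} (R : Set ℓ) where

  ¬R : Set ℓ → Set ℓ
  ¬R Q = Q → R

  infix 4 _≈_
  _≈_ : Set ℓ → Set ℓ → Set ℓ
  Q ≈ S = (¬R Q → ¬R S) × (¬R S → ¬R Q)

  ⇔⇒≈ : ∀ {Q S} → (Q → S) → (S → Q) → Q ≈ S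
  ⇔⇒≈ to from = (λ k → k ∘ from) , (λ k → k ∘ to)

  ↔⇒≈ : ∀ {Q S} → Q ↔ S → Q ≈ S
  ↔⇒≈ i = ⇔⇒≈ (Inverse.to i) (Inverse.from i)

  ¬⊎-map : ∀ {x y u v : Set ℓ} → (¬R x → ¬R y) → (¬R u → ¬R v) → ¬R (x ⊎ u) → ¬R (y ⊎ v)
  ¬⊎-map f g k = [ f (k ∘ inj₁) , g (k ∘ inj₂) ]

  ¬×-map : ∀ {x y u v : Set ℓ} → (¬R x → ¬R y) → (¬R u → ¬R v) → ¬R (x × u) → ¬R (y × v)
  ¬×-map f g k (b , d) = f (λ a → g (λ c → k (a , c)) d) b

  isLattice : IsLattice _≈_ _⊎_ _×_
  isLattice = record
    { isEquivalence = record
      { refl  = id , id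
      ; sym   = swap
      ; trans = λ { (f , g) (f′ , g′) → f′ ∘ f , g ∘ g′ } }
    ; ∨-comm     = λ x y → ↔⇒≈ (⊎-comm x y)
    ; ∨-assoc    = λ x y z → ↔⇒≈ (⊎-assoc ℓ x y z)
    ; ∨-cong     = λ { (f , g) (f′ , g′) → ¬⊎-map f f′ , ¬⊎-map g g′ }
    ; ∧-comm     = λ x y → ↔⇒≈ (×-comm x y)
    ; ∧-assoc    = λ x y z → ↔⇒≈ (×-assoc ℓ x y z)
    ; ∧-cong     = λ { (f , g) (f′ , g′) → ¬×-map f f′ , ¬×-map g g′ }
    ; absorptive = (λ x y → ⇔⇒≈ [ id , proj₁ ] inj₁)
                 , (λ x y → ⇔⇒≈ proj₁ (λ a → a , inj₁ a))
    }

  -- (y ∧ z) ∨ x ⇔ (y ∨ x) ∧ (z ∨ x) holds already intuitionistically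
  ∨-distribʳ-∧ : (x y z : Set ℓ) → ((y × z) ⊎ x) ≈ ((y ⊎ x) × (z ⊎ x))
  ∨-distribʳ-∧ x y z = ⇔⇒≈ [ to , (λ a → inj₂ a , inj₂ a) ] from
    where
    to : y × z → (y ⊎ x) × (z ⊎ x)
    to (b , c) = inj₁ b , inj₁ c

    from : (y ⊎ x) × (z ⊎ x) → (y × z) ⊎ x
    from (inj₂ a , _)      = inj₂ a
    from (inj₁ _ , inj₂ a) = inj₂ a
    from (inj₁ b , inj₁ c) = inj₁ (b , c)

  Props : BooleanAlgebra (lsuc ℓ) ℓ
  Props = record
    { isBooleanAlgebra = isBooleanAlgebraʳ record
      { isDistributiveLattice = isDistributiveLatticeʳʲᵐ record
        { isLattice = isLattice ; ∨-distribʳ-∧ = ∨-distribʳ-∧ }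
      -- excluded middle and non-contradiction hold up to R-negation
      ; ∨-complementʳ = λ x → (λ k _ → k (inj₂ (k ∘ inj₁))) , (λ k _ → k (lift tt))
      ; ∧-complementʳ = λ x → (λ _ r → r) , (λ { k (q , nq) → k (nq q) })
      ; ¬-cong        = λ { (f , g) → (λ k → k ∘ g) , (λ k → k ∘ f) }
      }
    }

  refutable⇒≈⊥ : ∀ {Q} → (Q → Empty) → Q ≈ R
  refutable⇒≈⊥ ¬Q = (λ _ r → r) , (λ _ q → ⊥-elim (¬Q q))

  all⇒∏ : ∀ {t} {T : Set t} (g : T → Set ℓ) (L : List T) →
          (∀ {z} → z ∈ L → g z) → ∏ Props (map g L)
  all⇒∏ g []      _   = lift tt
  all⇒∏ g (z ∷ L) all = all (here ≡.refl) , all⇒∏ g L (all ∘ there)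

  ∏⇒all : ∀ {t} {T : Set t} (g : T → Set ℓ) (L : List T) →
          ∏ Props (map g L) → ∀ {z} → z ∈ L → g z
  ∏⇒all g (z ∷ L) (q , _)  (here ≡.refl) = q
  ∏⇒all g (z ∷ L) (_ , qs) (there m)     = ∏⇒all g L qs m

  ∑-elim : ∀ {t} {T : Set t} (g : T → Set ℓ) (L : List T) →
           (∀ {z} → z ∈ L → g z → R) → ∑ Props (map g L) → R
  ∑-elim g []      _      r        = r
  ∑-elim g (z ∷ L) refute (inj₁ q) = refute (here ≡.refl) q
  ∑-elim g (z ∷ L) refute (inj₂ s) = ∑-elim g L (refute ∘ there) s

  ≤-elim : ∀ {Q S} → _≤_ Props Q S → Q → ¬R S → R
  ≤-elim (¬Q∧S⇒¬Q , _) q ¬S = ¬Q∧S⇒¬Q (λ { (_ , s) → ¬S s }) q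

open PropositionAlgebra using (Props)

Bool-nontrivial : Nontrivial ∨-∧-booleanAlgebra
Bool-nontrivial ()

module _ {c₁ ℓ₁ c₂ ℓ₂} (B₁ : BooleanAlgebra c₁ ℓ₁) (B₂ : BooleanAlgebra c₂ ℓ₂) where
  private
    module B₁ = BooleanAlgebra B₁
    module B₂ = BooleanAlgebra B₂

  product : BooleanAlgebra (c₁ ⊔ c₂) (ℓ₁ ⊔ ℓ₂)
  product = record
    { Carrier = B₁.Carrier × B₂.Carrier
    ; _≈_ = Pointwise B₁._≈_ B₂._≈_
    ; _∨_ = λ { (x₁ , x₂) (y₁ , y₂) → x₁ B₁.∨ y₁ , x₂ B₂.∨ y₂ }
    ; _∧_ = λ { (x₁ , x₂) (y₁ , y₂) → x₁ B₁.∧ y₁ , x₂ B₂.∧ y₂ }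
    ; ¬_  = λ { (x₁ , x₂) → B₁.¬ x₁ , B₂.¬ x₂ }
    ; ⊤ = B₁.⊤ , B₂.⊤
    ; ⊥ = B₁.⊥ , B₂.⊥
    ; isBooleanAlgebra = isBooleanAlgebraʳ record
      { isDistributiveLattice = isDistributiveLatticeʳʲᵐ record
        { isLattice = record
          { isEquivalence = ×-isEquivalence B₁.isEquivalence B₂.isEquivalence
          ; ∨-comm  = λ _ _ → B₁.∨-comm _ _ , B₂.∨-comm _ _
          ; ∨-assoc = λ _ _ _ → B₁.∨-assoc _ _ _ , B₂.∨-assoc _ _ _
          ; ∨-cong  = λ { (p₁ , p₂) (q₁ , q₂) → B₁.∨-cong p₁ q₁ , B₂.∨-cong p₂ q₂ }
          ; ∧-comm  = λ _ _ → B₁.∧-comm _ _ , B₂.∧-comm _ _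
          ; ∧-assoc = λ _ _ _ → B₁.∧-assoc _ _ _ , B₂.∧-assoc _ _ _
          ; ∧-cong  = λ { (p₁ , p₂) (q₁ , q₂) → B₁.∧-cong p₁ q₁ , B₂.∧-cong p₂ q₂ }
          ; absorptive = (λ _ _ → B₁.∨-absorbs-∧ _ _ , B₂.∨-absorbs-∧ _ _)
                       , (λ _ _ → B₁.∧-absorbs-∨ _ _ , B₂.∧-absorbs-∨ _ _)
          }
        ; ∨-distribʳ-∧ = λ _ _ _ → B₁.∨-distribʳ-∧ _ _ _ , B₂.∨-distribʳ-∧ _ _ _
        }
      ; ∨-complementʳ = λ _ → B₁.∨-complementʳ _ , B₂.∨-complementʳ _
      ; ∧-complementʳ = λ _ → B₁.∧-complementʳ _ , B₂.∧-complementʳ _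
      ; ¬-cong = λ { (p₁ , p₂) → B₁.¬-cong p₁ , B₂.¬-cong p₂ }
      }
    }

  product-nontrivial : Nontrivial B₂ → Nontrivial product
  product-nontrivial nt₂ (_ , ⊤≈⊥) = nt₂ ⊤≈⊥

  proj₁-hom : ∀ {a ℓa} {A : BooleanAlgebra a ℓa} {h : BooleanAlgebra.Carrier A → B₁.Carrier × B₂.Carrier} →
              IsBAHom A product h → IsBAHom A B₁ (proj₁ ∘ h)
  proj₁-hom hom = record
    { cong  = proj₁ ∘ cong
    ; ∨-hom = λ x y → proj₁ (∨-hom x y)
    ; ∧-hom = λ x y → proj₁ (∧-hom x y)
    ; ¬-hom = λ x → proj₁ (¬-hom x)
    ; ⊤-hom = proj₁ ⊤-hom
    ; ⊥-hom = proj₁ ⊥-hom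
    }
    where open IsBAHom hom

  module _ {a ℓa p} {A : BooleanAlgebra a ℓa} {U : Subset A p} where

    pair : SubFun A B₁ U → SubFun A B₂ U → SubFun A product U
    pair f₁ f₂ = record
      { fun  = λ x px → SubFun.fun f₁ x px , SubFun.fun f₂ x px
      ; resp = λ px py x≈y → SubFun.resp f₁ px py x≈y , SubFun.resp f₂ px py x≈y
      }

    pair-ωpreserving : (f₁ : SubFun A B₁ U) (f₂ : SubFun A B₂ U) →
      OmegaPreserving A B₁ U f₁ → OmegaPreserving A B₂ U f₂ →
      OmegaPreserving A product U (pair f₁ f₂)
    pair-ωpreserving f₁ f₂ ω₁ ω₂ H ∏H≈⊥ =
      B₁.trans (∏₁ H) (ω₁ H ∏H≈⊥) , B₂.trans (∏₂ H) (ω₂ H ∏H≈⊥)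
      where
      ∏₁ : ∀ H → proj₁ (∏ product (map (apply A product U (pair f₁ f₂)) H)) B₁.≈ ∏ B₁ (map (apply A B₁ U f₁) H)
      ∏₁ []      = B₁.refl
      ∏₁ (_ ∷ H) = B₁.∧-cong B₁.refl (∏₁ H)
      ∏₂ : ∀ H → proj₂ (∏ product (map (apply A product U (pair f₁ f₂)) H)) B₂.≈ ∏ B₂ (map (apply A B₂ U f₂) H)
      ∏₂ []      = B₂.refl
      ∏₂ (_ ∷ H) = B₂.∧-cong B₂.refl (∏₂ H)

module Order {b ℓb} (B : BooleanAlgebra b ℓb) where
  open BooleanAlgebra B
  open BooleanAlgebraProperties B using (∧-idem; ∧-zeroʳ; ∧-identityʳ)
  open SetoidReasoning setoid

  ≤-resp-≈ : ∀ {x x′ y y′} → x ≈ x′ → y ≈ y′ → _≤_ B x y → _≤_ B x′ y′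
  ≤-resp-≈ {x} {x′} {y} {y′} x≈x′ y≈y′ x≤y = begin
    x′ ∧ y′ ≈⟨ ∧-cong (sym x≈x′) (sym y≈y′) ⟩
    x ∧ y   ≈⟨ x≤y ⟩
    x       ≈⟨ x≈x′ ⟩
    x′      ∎

  ≤⊥⇒≈⊥ : ∀ {x y} → _≤_ B x y → y ≈ ⊥ → x ≈ ⊥
  ≤⊥⇒≈⊥ {x} {y} x≤y y≈⊥ = begin
    x     ≈⟨ sym x≤y ⟩
    x ∧ y ≈⟨ ∧-cong refl y≈⊥ ⟩
    x ∧ ⊥ ≈⟨ ∧-zeroʳ x ⟩
    ⊥     ∎

  ∏-lowerBound : ∀ {t} {T : Set t} (g : T → Carrier) (L : List T) →
                 ∀ {z} → z ∈ L → _≤_ B (∏ B (map g L)) (g z)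
  ∏-lowerBound g (z ∷ L) (here ≡.refl) = begin
    (g z ∧ r) ∧ g z ≈⟨ ∧-comm _ _ ⟩
    g z ∧ (g z ∧ r) ≈⟨ sym (∧-assoc _ _ _) ⟩
    (g z ∧ g z) ∧ r ≈⟨ ∧-cong (∧-idem _) refl ⟩
    g z ∧ r         ∎
    where r = ∏ B (map g L)
  ∏-lowerBound g (y ∷ L) {z} (there m) = begin
    (g y ∧ r) ∧ g z ≈⟨ ∧-assoc _ _ _ ⟩
    g y ∧ (r ∧ g z) ≈⟨ ∧-cong refl (∏-lowerBound g L m) ⟩
    g y ∧ r         ∎
    where r = ∏ B (map g L)

  ∏-greatest : ∀ {t} {T : Set t} (g : T → Carrier) (L : List T) {x} →
               (∀ {z} → z ∈ L → _≤_ B x (g z)) → _≤_ B x (∏ B (map g L))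
  ∏-greatest g []      {x} _      = ∧-identityʳ x
  ∏-greatest g (z ∷ L) {x} bound = begin
    x ∧ (g z ∧ r) ≈⟨ sym (∧-assoc _ _ _) ⟩
    (x ∧ g z) ∧ r ≈⟨ ∧-cong (bound (here ≡.refl)) refl ⟩
    x ∧ r         ≈⟨ ∏-greatest g L (bound ∘ there) ⟩
    x             ∎
    where r = ∏ B (map g L)

module Transfer {a ℓa b ℓb p q} {A : BooleanAlgebra a ℓa} {B : BooleanAlgebra b ℓb}
                {U : Subset A p} {V : Subset A q} (V⊆U : ∀ {x} → V x → U x)
                (f : SubFun A B U) {h : BooleanAlgebra.Carrier A → BooleanAlgebra.Carrier B}
                (hom : IsBAHom A B h) (ext : Extends A B U f h) where
  private
    module A = BooleanAlgebra A
  open BooleanAlgebra B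
  open IsBAHom hom
  open SetoidReasoning setoid

  f∣V : El A V → Carrier
  f∣V (x , vx) = SubFun.fun f x (V⊆U vx)

  hom-∏ : (H : List (El A V)) → h (∏ A (map proj₁ H)) ≈ ∏ B (map f∣V H)
  hom-∏ []             = ⊤-hom
  hom-∏ ((x , vx) ∷ H) = trans (∧-hom _ _) (∧-cong (ext x (V⊆U vx)) (hom-∏ H))

  hom-∑ : (H : List (El A V)) → h (∑ A (map proj₁ H)) ≈ ∑ B (map f∣V H)
  hom-∑ []             = ⊥-hom
  hom-∑ ((x , vx) ∷ H) = trans (∨-hom _ _) (∨-cong (ext x (V⊆U vx)) (hom-∑ H))

  hom-≤ : ∀ {x y} → _≤_ A x y → _≤_ B (h x) (h y)
  hom-≤ {x} {y} x≤y = begin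
    h x ∧ h y   ≈⟨ sym (∧-hom x y) ⟩
    h (x A.∧ y) ≈⟨ cong x≤y ⟩
    h x         ∎

  transfer-≤ : (F G : List (El A V)) → _≤_ A (∏ A (map proj₁ F)) (∑ A (map proj₁ G)) →
               _≤_ B (∏ B (map f∣V F)) (∑ B (map f∣V G))
  transfer-≤ F G ∏F≤∑G = Order.≤-resp-≈ B (hom-∏ F) (hom-∑ G) (hom-≤ ∏F≤∑G)

module _ {a ℓa p} (A : BooleanAlgebra a ℓa) (U : Subset A p) where

  constFalse : SubFun A ∨-∧-booleanAlgebra U
  constFalse = record { fun = λ _ _ → false ; resp = λ _ _ _ → ≡.refl }

  -- ω-preserving because the empty meet 1 is nonzero in a nontrivial A, while
  -- any nonempty meet of falses is false
  constFalse-ωpreserving : Nontrivial A → OmegaPreserving A ∨-∧-booleanAlgebra U constFalse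
  constFalse-ωpreserving ntA []      ⊤≈⊥ = ⊥-elim (ntA ⊤≈⊥)
  constFalse-ωpreserving ntA (_ ∷ _) _   = ≡.refl

∑-false : ∀ {t} {T : Set t} (L : List T) → ∑ ∨-∧-booleanAlgebra (map (λ _ → false) L) ≡ false
∑-false []      = ≡.refl
∑-false (_ ∷ L) = ∑-false L

module Independence {a ℓa p} (A : BooleanAlgebra a ℓa) (X : Subset A p)
                    (ntA : Nontrivial A) (free : OmegaFree A X) where
  open BooleanAlgebra A hiding (¬_)
  open Order A using (≤-resp-≈; ≤⊥⇒≈⊥; ∏-lowerBound; ∏-greatest)

  X⁺ : Set (a ⊔ p ⊔ ℓa)
  X⁺ = El A (Plus A X)

  X⁺⊆X : ∀ {x} → Plus A X x → X x
  X⁺⊆X = proj₁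

  no-finite-cover : (F : List X⁺) → ¬ (∑ A (map proj₁ F) ≈ ⊤)
  no-finite-cover F ∑F≈⊤ with proj₁ (free ∨-∧-booleanAlgebra Bool-nontrivial (constFalse A X)
                                           (constFalse-ωpreserving A X ntA))
  ... | h , hom , ext = Bool-nontrivial (begin
    true                                     ≡⟨ ≡.sym (IsBAHom.⊤-hom hom) ⟩
    h ⊤                                      ≡⟨ ≡.sym (IsBAHom.cong hom ∑F≈⊤) ⟩
    h (∑ A (map proj₁ F))                    ≡⟨ Transfer.hom-∑ X⁺⊆X (constFalse A X) hom ext F ⟩
    ∑ ∨-∧-booleanAlgebra (map (λ _ → false) F) ≡⟨ ∑-false F ⟩
    false                                    ∎)
    where open ≡.≡-Reasoning

  module _ (F G : List X⁺) where

    Shared : Set (a ⊔ p ⊔ ℓa)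
    Shared = ∃[ x ] (x ∈ F × ∃[ y ] (y ∈ G × proj₁ x ≈ proj₁ y))

    open PropositionAlgebra Shared using (⇔⇒≈; refutable⇒≈⊥; all⇒∏; ∏⇒all; ∑-elim; ≤-elim)

    InF : Carrier → Set (a ⊔ p ⊔ ℓa)
    InF x = ∃[ z ] (z ∈ F × x ≈ proj₁ z)

    InF-resp : ∀ {x y} → x ≈ y → InF x → InF y
    InF-resp x≈y (z , z∈F , x≈z) = z , z∈F , trans (sym x≈y) x≈z

    inF : SubFun A (Props Shared) X
    inF = record
      { fun  = λ x _ → InF x
      ; resp = λ _ _ x≈y → ⇔⇒≈ (InF-resp x≈y) (InF-resp (sym x≈y))
      }

    -- if every member of H lies in F then ∏F ≤ ∏H; so when ∏F ≠ 0 and ∏H = 0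
    -- the proposition "every member of H lies in F" is refutable, i.e. it is
    -- the bottom of Props Shared
    inF-ωpreserving : ¬ (∏ A (map proj₁ F) ≈ ⊥) → OmegaPreserving A (Props Shared) X inF
    inF-ωpreserving ∏F≉⊥ H ∏H≈⊥ = refutable⇒≈⊥ λ allInF →
      ∏F≉⊥ (≤⊥⇒≈⊥ (∏-greatest proj₁ H (∏F≤ ∘ ∏⇒all (InF ∘ proj₁) H allInF)) ∏H≈⊥)
      where
      ∏F≤ : ∀ {x} → InF x → _≤_ A (∏ A (map proj₁ F)) x
      ∏F≤ (z , z∈F , x≈z) = ≤-resp-≈ refl (sym x≈z) (∏-lowerBound proj₁ F z∈F)

    Test : BooleanAlgebra (lsuc (a ⊔ p ⊔ ℓa)) (a ⊔ p ⊔ ℓa)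
    Test = product (Props Shared) ∨-∧-booleanAlgebra

    test : SubFun A Test X
    test = pair (Props Shared) ∨-∧-booleanAlgebra inF (constFalse A X)

    test-ωpreserving : ¬ (∏ A (map proj₁ F) ≈ ⊥) → OmegaPreserving A Test X test
    test-ωpreserving ∏F≉⊥ = pair-ωpreserving (Props Shared) ∨-∧-booleanAlgebra inF (constFalse A X)
                              (inF-ωpreserving ∏F≉⊥) (constFalse-ωpreserving A X ntA)

    -- (⊥3): the first component of the extension h of test is a homomorphism
    -- extending inF; it turns ∏F ≤ ∑G into an inequality in Props Shared,
    -- where ∏F holds and every summand of ∑G yields Shared.
    shared-member : ¬ (∏ A (map proj₁ F) ≈ ⊥) → _≤_ A (∏ A (map proj₁ F)) (∑ A (map proj₁ G)) → Shared
    shared-member ∏F≉⊥ ∏F≤∑G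
      with proj₁ (free Test (product-nontrivial (Props Shared) ∨-∧-booleanAlgebra Bool-nontrivial)
                       test (test-ωpreserving ∏F≉⊥))
    ... | h , hom , ext = ≤-elim ∏InF≤∑InG ∏InF-holds ∑InG-refuted
      where
      ∏InF ∑InG : Set (a ⊔ p ⊔ ℓa)
      ∏InF = ∏ (Props Shared) (map (InF ∘ proj₁) F)
      ∑InG = ∑ (Props Shared) (map (InF ∘ proj₁) G)

      ∏InF≤∑InG : _≤_ (Props Shared) ∏InF ∑InG
      ∏InF≤∑InG = Transfer.transfer-≤ X⁺⊆X inF (proj₁-hom (Props Shared) ∨-∧-booleanAlgebra hom)
                    (λ x px → proj₁ (ext x px)) F G ∏F≤∑G
      ∏InF-holds : ∏InF
      ∏InF-holds = all⇒∏ (InF ∘ proj₁) F (λ {z} z∈F → z , z∈F , refl {proj₁ z})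
      ∑InG-refuted : ∑InG → Shared
      ∑InG-refuted = ∑-elim (InF ∘ proj₁) G (λ {y} y∈G (z , z∈F , y≈z) → z , z∈F , y , y∈G , sym y≈z)

mainTheorem1 : ∀ {a ℓa p} (A : BooleanAlgebra a ℓa) (X : Subset A p) →
    Nontrivial A → OmegaFree A X → OmegaIndependent A (Plus A X)
mainTheorem1 A X ntA free = record
  { zero∉ = λ _ → proj₂
  ; ⊥1    = λ F _ → no-finite-cover F
  ; ⊥3    = λ F G _ _ → shared-member F G
  }
  where open Independence A X ntA free
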